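{- \[ T_{1} + \bigcup_{m \in \mathbb{N}} \mathrm{IND}^{m+1}(\mathrm{Open}(\mathcal{L}_{1})) \not\vdash Y \frown X = X \rightarrow Y = \mathit{nil}. \]
   Context: We work in classical many-sorted first-order logic with equality. The language $\mathcal{L}_{0}$ has sorts $\mathsf{i}$ (elements) and $\mathsf{list}$, and function symbols $\mathit{nil}:\mathsf{list}$, $\mathit{cons}:\mathsf{i}\times\mathsf{list}\to\mathsf{list}$. The language $\mathcal{L}_{1}$ extends $\mathcal{L}_0$ by an infix function symbol $\frown:\mathsf{list}\times\mathsf{list}\to\mathsf{list}$. The theory $T_{1}$ is axiomatized by the universal closures of: $\mathit{nil}\neq\mathit{cons}(x,X)$; $\mathit{cons}(x,X)=\mathit{cons}(y,Y)\rightarrow x=y\wedge X=Y$; $\mathit{nil}\frown Y = Y$; $\mathit{cons}(x,X)\frown Y = \mathit{cons}(x, X\frown Y)$. For terms $t_1,\dots,t_n$ of sort $\mathsf{i}$ and $T$ of sort $\mathsf{list}$, $\mathit{cons}(t_1,\dots,t_n;T)$ abbreviates $\mathit{cons}(t_1,\mathit{cons}(t_2,\dots,\mathit{cons}(t_n,T)\dots))$ ($=T$ if $n=0$). For a formula $\varphi(X,\vec z)$ and $m\ge1$, the $m$-step induction axiom $I^{m}_{X}\varphi$ is \[ \Big(\bigwedge_{i=1}^{m} \forall x_1\dots\forall x_{i-1}\, \varphi(\mathit{cons}(x_1,\dots,x_{i-1};\mathit{nil}),\vec z) \wedge \forall X\,\forall x_1\dots\forall x_m\,\big(\varphi(X,\vec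 z)\rightarrow \varphi(\mathit{cons}(x_1,\dots,x_m;X),\vec z)\big)\Big) \rightarrow \forall X\,\varphi(X,\vec z). \] $\mathrm{IND}^{m}(\Phi)$ is axiomatized by the universal closures of $I^{m}_{X}\varphi$ for $\varphi\in\Phi$; $\mathrm{Open}(\mathcal{L})$ is the set of quantifier-free $\mathcal{L}$-formulas. -}

module Defs where

open import Data.Nat using (ℕ; zero; suc)
open import Data.List using (List; []; _∷_; map; _++_; foldr)
open import Data.List.Membership.Propositional using (_∈_)

data Sort : Set where
  ι lst : Sort

Ctx : Set
Ctx = List Sort

infix 4 _∋_
data _∋_ : Ctx → Sort → Set where
  here  : ∀ {Γ s} → (s ∷ Γ) ∋ s
  there : ∀ {Γ s t} → Γ ∋ s → (t ∷ Γ) ∋ s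

infixr 6 _⌢_
data Term (Γ : Ctx) : Sort → Set where
  var  : ∀ {s} → Γ ∋ s → Term Γ s
  nil  : Term Γ lst
  cons : Term Γ ι → Term Γ lst → Term Γ lst
  _⌢_  : Term Γ lst → Term Γ lst → Term Γ lst

infix 4 _≐_
infixr 3 _∧ᶠ_
infixr 2 _∨ᶠ_
infixr 1 _⇒_
data Formula (Γ : Ctx) : Set where
  ⊥ᶠ   : Formula Γ
  _≐_  : ∀ {s} → Term Γ s → Term Γ s → Formula Γ
  _⇒_  : Formula Γ → Formula Γ → Formula Γ
  _∧ᶠ_ : Formula Γ → Formula Γ → Formula Γ
  _∨ᶠ_ : Formula Γ → Formula Γ → Formula Γ
  ∀ᶠ   : (s : Sort) → Formula (s ∷ Γ) → Formula Γ
  ∃ᶠ   : (s : Sort) → Formula (s ∷ Γ) → Formula Γ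

¬ᶠ : ∀ {Γ} → Formula Γ → Formula Γ
¬ᶠ φ = φ ⇒ ⊥ᶠ

data QF {Γ : Ctx} : Formula Γ → Set where
  qf⊥ : QF ⊥ᶠ
  qf≐ : ∀ {s} {t u : Term Γ s} → QF (t ≐ u)
  qf⇒ : ∀ {φ ψ} → QF φ → QF ψ → QF (φ ⇒ ψ)
  qf∧ : ∀ {φ ψ} → QF φ → QF ψ → QF (φ ∧ᶠ ψ)
  qf∨ : ∀ {φ ψ} → QF φ → QF ψ → QF (φ ∨ᶠ ψ)

Ren : Ctx → Ctx → Set
Ren Γ Δ = ∀ {s} → Γ ∋ s → Δ ∋ s

Sub : Ctx → Ctx → Set
Sub Γ Δ = ∀ {s} → Γ ∋ s → Term Δ s

liftR : ∀ {Γ Δ t} → Ren Γ Δ → Ren (t ∷ Γ) (t ∷ Δ)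
liftR ρ here      = here
liftR ρ (there x) = there (ρ x)

renT : ∀ {Γ Δ s} → Ren Γ Δ → Term Γ s → Term Δ s
renT ρ (var x)    = var (ρ x)
renT ρ nil        = nil
renT ρ (cons t T) = cons (renT ρ t) (renT ρ T)
renT ρ (T ⌢ U)    = renT ρ T ⌢ renT ρ U

renF : ∀ {Γ Δ} → Ren Γ Δ → Formula Γ → Formula Δ
renF ρ ⊥ᶠ        = ⊥ᶠ
renF ρ (t ≐ u)   = renT ρ t ≐ renT ρ u
renF ρ (φ ⇒ ψ)   = renF ρ φ ⇒ renF ρ ψ
renF ρ (φ ∧ᶠ ψ)  = renF ρ φ ∧ᶠ renF ρ ψ
renF ρ (φ ∨ᶠ ψ)  = renF ρ φ ∨ᶠ renF ρ ψ
renF ρ (∀ᶠ s φ)  = ∀ᶠ s (renF (liftR ρ) φ)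
renF ρ (∃ᶠ s φ)  = ∃ᶠ s (renF (liftR ρ) φ)

liftS : ∀ {Γ Δ t} → Sub Γ Δ → Sub (t ∷ Γ) (t ∷ Δ)
liftS σ here      = var here
liftS σ (there x) = renT there (σ x)

subT : ∀ {Γ Δ s} → Sub Γ Δ → Term Γ s → Term Δ s
subT σ (var x)    = σ x
subT σ nil        = nil
subT σ (cons t T) = cons (subT σ t) (subT σ T)
subT σ (T ⌢ U)    = subT σ T ⌢ subT σ U

subF : ∀ {Γ Δ} → Sub Γ Δ → Formula Γ → Formula Δ
subF σ ⊥ᶠ        = ⊥ᶠ
subF σ (t ≐ u)   = subT σ t ≐ subT σ u
subF σ (φ ⇒ ψ)   = subF σ φ ⇒ subF σ ψ
subF σ (φ ∧ᶠ ψ)  = subF σ φ ∧ᶠ subF σ ψ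
subF σ (φ ∨ᶠ ψ)  = subF σ φ ∨ᶠ subF σ ψ
subF σ (∀ᶠ s φ)  = ∀ᶠ s (subF (liftS σ) φ)
subF σ (∃ᶠ s φ)  = ∃ᶠ s (subF (liftS σ) φ)

wk : ∀ {Γ t} → Formula Γ → Formula (t ∷ Γ)
wk = renF there

sub0 : ∀ {Γ s} → Term Γ s → Sub (s ∷ Γ) Γ
sub0 t here      = t
sub0 t (there x) = var x

_[_] : ∀ {Γ s} → Formula (s ∷ Γ) → Term Γ s → Formula Γ
φ [ t ] = subF (sub0 t) φ

closedToCtx : ∀ {Γ} → Ren [] Γ
closedToCtx ()

data Deriv (Ax : Formula [] → Set) : (Γ : Ctx) → List (Formula Γ) → Formula Γ → Set where
  ax   : ∀ {Γ Hs ψ} → Ax ψ → Deriv Ax Γ Hs (renF closedToCtx ψ)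
  hyp  : ∀ {Γ Hs φ} → φ ∈ Hs → Deriv Ax Γ Hs φ
  raa  : ∀ {Γ Hs φ} → Deriv Ax Γ (¬ᶠ φ ∷ Hs) ⊥ᶠ → Deriv Ax Γ Hs φ
  ⇒I   : ∀ {Γ Hs φ ψ} → Deriv Ax Γ (φ ∷ Hs) ψ → Deriv Ax Γ Hs (φ ⇒ ψ)
  ⇒E   : ∀ {Γ Hs φ ψ} → Deriv Ax Γ Hs (φ ⇒ ψ) → Deriv Ax Γ Hs φ → Deriv Ax Γ Hs ψ
  ∧I   : ∀ {Γ Hs φ ψ} → Deriv Ax Γ Hs φ → Deriv Ax Γ Hs ψ → Deriv Ax Γ Hs (φ ∧ᶠ ψ)
  ∧E₁  : ∀ {Γ Hs φ ψ} → Deriv Ax Γ Hs (φ ∧ᶠ ψ) → Deriv Ax Γ Hs φ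
  ∧E₂  : ∀ {Γ Hs φ ψ} → Deriv Ax Γ Hs (φ ∧ᶠ ψ) → Deriv Ax Γ Hs ψ
  ∨I₁  : ∀ {Γ Hs φ ψ} → Deriv Ax Γ Hs φ → Deriv Ax Γ Hs (φ ∨ᶠ ψ)
  ∨I₂  : ∀ {Γ Hs φ ψ} → Deriv Ax Γ Hs ψ → Deriv Ax Γ Hs (φ ∨ᶠ ψ)
  ∨E   : ∀ {Γ Hs φ ψ χ} → Deriv Ax Γ Hs (φ ∨ᶠ ψ) → Deriv Ax Γ (φ ∷ Hs) χ
         → Deriv Ax Γ (ψ ∷ Hs) χ → Deriv Ax Γ Hs χ
  ∀I   : ∀ {Γ Hs s φ} → Deriv Ax (s ∷ Γ) (map wk Hs) φ → Deriv Ax Γ Hs (∀ᶠ s φ)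
  ∀E   : ∀ {Γ Hs s φ} → Deriv Ax Γ Hs (∀ᶠ s φ) → (t : Term Γ s) → Deriv Ax Γ Hs (φ [ t ])
  ∃I   : ∀ {Γ Hs s φ} → (t : Term Γ s) → Deriv Ax Γ Hs (φ [ t ]) → Deriv Ax Γ Hs (∃ᶠ s φ)
  ∃E   : ∀ {Γ Hs s φ ψ} → Deriv Ax Γ Hs (∃ᶠ s φ)
         → Deriv Ax (s ∷ Γ) (φ ∷ map wk Hs) (wk ψ) → Deriv Ax Γ Hs ψ
  ≐I   : ∀ {Γ Hs s} (t : Term Γ s) → Deriv Ax Γ Hs (t ≐ t)
  ≐E   : ∀ {Γ Hs s} {t u : Term Γ s} (φ : Formula (s ∷ Γ))
         → Deriv Ax Γ Hs (t ≐ u) → Deriv Ax Γ Hs (φ [ t ]) → Deriv Ax Γ Hs (φ [ u ])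
  -- domains are nonempty: a variable not occurring in the conclusion can be discharged
  nonempty : ∀ {Γ Hs φ} (s : Sort) → Deriv Ax (s ∷ Γ) (map wk Hs) (wk φ) → Deriv Ax Γ Hs φ

_⊢_ : (Formula [] → Set) → Formula [] → Set
T ⊢ φ = Deriv T [] [] φ

close : ∀ Δ → Formula Δ → Formula []
close []      φ = φ
close (s ∷ Δ) φ = close Δ (∀ᶠ s φ)

iCtx : ℕ → Ctx → Ctx
iCtx zero    Δ = Δ
iCtx (suc k) Δ = ι ∷ iCtx k Δ

-- ∀x₁ … ∀x_k (x₁ outermost)
∀ι* : ∀ {Δ} k → Formula (iCtx k Δ) → Formula Δ
∀ι* zero    φ = φ
∀ι* (suc k) φ = ∀ι* k (∀ᶠ ι φ)

wkN : ∀ {Δ} k → Ren Δ (iCtx k Δ)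
wkN zero    x = x
wkN (suc k) x = there (wkN k x)

vars : ∀ {Δ} k → List (Term (iCtx k Δ) ι)
vars zero    = []
vars (suc k) = map (renT there) (vars k) ++ (var here ∷ [])

consL : ∀ {Γ} → List (Term Γ ι) → Term Γ lst → Term Γ lst
consL ts T = foldr cons T ts

instX : ∀ {Δ} k → Term (iCtx k Δ) lst → Sub (lst ∷ Δ) (iCtx k Δ)
instX k T here      = T
instX k T (there x) = var (wkN k x)

baseCase : ∀ {Δ} → Formula (lst ∷ Δ) → ℕ → Formula Δ
baseCase φ k = ∀ι* k (subF (instX k (consL (vars k) nil)) φ)

baseCases : ∀ {Δ} → Formula (lst ∷ Δ) → ℕ → Formula Δ
baseCases φ zero    = baseCase φ zero
baseCases φ (suc n) = baseCases φ n ∧ᶠ baseCase φ (suc n)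

stepCase : ∀ {Δ} → Formula (lst ∷ Δ) → ℕ → Formula Δ
stepCase φ m =
  ∀ᶠ lst (∀ι* m (renF (wkN m) φ
                 ⇒ subF (instX m (consL (vars m) (var (wkN m here)))) (renF (liftR there) φ)))

-- I^{m}_X φ for m = suc n ≥ 1, as a formula with free variables z⃗ ∈ Δ
Ind : ∀ {Δ} → ℕ → Formula (lst ∷ Δ) → Formula Δ
Ind n φ = (baseCases φ n ∧ᶠ stepCase φ (suc n)) ⇒ ∀ᶠ lst φ

private
  v0 : ∀ {Γ s} → Term (s ∷ Γ) s
  v0 = var here
  v1 : ∀ {Γ s t} → Term (t ∷ s ∷ Γ) s
  v1 = var (there here)
  v2 : ∀ {Γ s t u} → Term (u ∷ t ∷ s ∷ Γ) s
  v2 = var (there (there here))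
  v3 : ∀ {Γ s t u w} → Term (w ∷ u ∷ t ∷ s ∷ Γ) s
  v3 = var (there (there (there here)))

data T1+IND : Formula [] → Set where
  ax-nil≠cons : T1+IND (∀ᶠ lst (∀ᶠ ι (¬ᶠ (nil ≐ cons v0 v1))))
  ax-cons-inj : T1+IND (∀ᶠ lst (∀ᶠ ι (∀ᶠ lst (∀ᶠ ι
                  (cons v2 v3 ≐ cons v0 v1 ⇒ (v2 ≐ v0 ∧ᶠ v3 ≐ v1))))))
  ax-nil⌢ : T1+IND (∀ᶠ lst (nil ⌢ v0 ≐ v0))
  ax-cons⌢ : T1+IND (∀ᶠ lst (∀ᶠ ι (∀ᶠ lst (cons v1 v2 ⌢ v0 ≐ cons v1 (v2 ⌢ v0)))))
  ax-ind : (m : ℕ) (Δ : Ctx) (φ : Formula (lst ∷ Δ)) → QF φ → T1+IND (close Δ (Ind m φ))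

leftCancelNil : Formula []
leftCancelNil = ∀ᶠ lst (∀ᶠ lst (v0 ⌢ v1 ≐ v1 ⇒ v0 ≐ nil))

-- An element of sort list is a word over letters L k (k ∈ ℕ) and tokens S k, W k, normalised by
-- L k · S (k+1) → S k, L k · W (k+1) → W k and S k · W 0 → W k; cons(k, X) prepends L k and ⌢ is
-- concatenation followed by normalisation. Think of S k as the nonstandard list k, k+1, k+2, …
-- and of W k as S k ⌢ W 0. All axioms of T₁ hold, yet S 0 ⌢ W 0 = W 0 while S 0 ≠ nil.
--
-- For open induction: a token unfolds into arbitrarily many letters,
-- tok K = cons(K, …, K+d-1; tok (K+d)), so by m-step cons every word is reached from one whose
-- first token has an index i as large as we like. A quantifier-free formula whose parameters
-- only involve indices below B < i cannot tell that token from the fresh letter L B, because the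
-- substitutions tok i ↦ L B and L B ↦ tok i are partial homomorphisms fixing the parameters.
-- This trades the first token for a letter, and words of letters only are standard lists,
-- reached from the base cases.

module Submission where

open import Defs
open import Data.Empty using (⊥; ⊥-elim)
open import Data.List using (List; []; _∷_; map; foldr; length; reverse; _++_; _∷ʳ_; _ʳ++_)
import Data.List.Properties as Listₚ
open import Data.List.Relation.Unary.All as All using (All; []; _∷_)
open import Data.List.Relation.Unary.All.Properties using (map⁺)
open import Data.List.Relation.Unary.Linked as Linked using (Linked; []; [-]; _∷_)
open import Data.Maybe using (Maybe; just; nothing; maybe′)
open import Data.Nat using (ℕ; zero; suc; _+_; _*_; _≟_; _<_; _≤_; _⊔_; s≤s; z≤n)
open import Data.Nat.DivMod using (_%_; _/_; m≡m%n+[m/n]*n; m%n<n)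
open import Data.Nat.Properties
  using (n≤0⇒n≡0; m≤n⇒m<n∨m≡n; ≤-pred; ≤-trans; ≤-reflexive; <-irrefl; <-trans; ≤-<-trans; <⇒≢; n<1+n;
         suc-injective; +-suc; +-assoc; +-comm; *-suc; m≤m+n; m≤m⊔n; m≤n⊔m)
open import Data.Product using (Σ; Σ-syntax; _×_; _,_; proj₁; proj₂)
open import Data.Product.Function.NonDependent.Propositional using (_×-⇔_)
open import Data.Product.Properties using (,-injective)
open import Data.Sum using (_⊎_; inj₁; inj₂)
open import Data.Sum.Function.Propositional using (_⊎-⇔_)
open import Data.Unit using (⊤; tt)
open import Function using (_∘_; id)
open import Function.Bundles using (_⇔_; mk⇔; Equivalence)
open import Function.Construct.Identity using (⇔-id)
open import Function.Related.TypeIsomorphisms using (→-cong-⇔; ¬-cong-⇔)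
open import Relation.Binary.Definitions using (DecidableEquality)
open import Relation.Binary.PropositionalEquality
  using (_≡_; _≢_; refl; sym; trans; cong; cong₂; subst; module ≡-Reasoning)
open import Relation.Nullary using (¬_; yes; no)
open import Relation.Nullary.Decidable using (map′)

open Equivalence using (to; from)

All-reverse : ∀ {A : Set} {P : A → Set} {xs} → All P xs → All P (reverse xs)
All-reverse = go [] []
  where
  go : ∀ {A : Set} {P : A → Set} {xs} ys → All P ys → All P xs → All P (xs ʳ++ ys)
  go ys qs []       = qs
  go ys qs (p ∷ ps) = go (_ ∷ ys) (p ∷ qs) ps

record Structure : Set₁ where
  infixr 5 _⌢ᴹ_
  field
    Carrier   : Sort → Set
    Elem      : ∀ s → Carrier s → Set      -- the domain of sort s inside Carrier s
    _≟ᴹ_      : ∀ {s} → DecidableEquality (Carrier s)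
    witness   : ∀ s → Σ (Carrier s) (Elem s)
    nilᴹ      : Carrier lst
    consᴹ     : Carrier ι → Carrier lst → Carrier lst
    _⌢ᴹ_      : Carrier lst → Carrier lst → Carrier lst
    nil-elem  : Elem lst nilᴹ
    cons-elem : ∀ {x X} → Elem ι x → Elem lst X → Elem lst (consᴹ x X)
    ⌢-elem    : ∀ {X Y} → Elem lst X → Elem lst Y → Elem lst (X ⌢ᴹ Y)

  consᴹ* : List (Carrier ι) → Carrier lst → Carrier lst
  consᴹ* xs X = foldr consᴹ X xs

module Semantics (M : Structure) where
  open Structure M

  Env : Ctx → Set
  Env Γ = ∀ {s} → Γ ∋ s → Carrier s

  infixr 5 _∷ₑ_
  _∷ₑ_ : ∀ {Γ s} → Carrier s → Env Γ → Env (s ∷ Γ)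
  (v ∷ₑ ρ) here      = v
  (v ∷ₑ ρ) (there x) = ρ x

  ∅ : Env []
  ∅ ()

  ElemEnv : ∀ {Γ} → Env Γ → Set
  ElemEnv {Γ} ρ = ∀ {s} (x : Γ ∋ s) → Elem s (ρ x)

  ∷ₑ-elem : ∀ {Γ s} {v : Carrier s} {ρ : Env Γ} → Elem s v → ElemEnv ρ → ElemEnv (v ∷ₑ ρ)
  ∷ₑ-elem e E here      = e
  ∷ₑ-elem e E (there x) = E x

  eval : ∀ {Γ s} → Term Γ s → Env Γ → Carrier s
  eval (var x)    ρ = ρ x
  eval nil        ρ = nilᴹ
  eval (cons t T) ρ = consᴹ (eval t ρ) (eval T ρ)
  eval (T ⌢ U)    ρ = eval T ρ ⌢ᴹ eval U ρ

  eval-elem : ∀ {Γ s} (t : Term Γ s) {ρ : Env Γ} → ElemEnv ρ → Elem s (eval t ρ)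
  eval-elem (var x)    E = E x
  eval-elem nil        E = nil-elem
  eval-elem (cons t T) E = cons-elem (eval-elem t E) (eval-elem T E)
  eval-elem (T ⌢ U)    E = ⌢-elem (eval-elem T E) (eval-elem U E)

  -- ∨ and ∃ get the classical readings ¬¬(A ⊎ B) and ¬∀¬; as equality is decidable,
  -- every formula is then stable, which validates raa.
  ⟦_⟧ : ∀ {Γ} → Formula Γ → Env Γ → Set
  ⟦ ⊥ᶠ ⟧     ρ = ⊥
  ⟦ t ≐ u ⟧  ρ = eval t ρ ≡ eval u ρ
  ⟦ φ ⇒ ψ ⟧  ρ = ⟦ φ ⟧ ρ → ⟦ ψ ⟧ ρ
  ⟦ φ ∧ᶠ ψ ⟧ ρ = ⟦ φ ⟧ ρ × ⟦ ψ ⟧ ρ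
  ⟦ φ ∨ᶠ ψ ⟧ ρ = ¬ ¬ (⟦ φ ⟧ ρ ⊎ ⟦ ψ ⟧ ρ)
  ⟦ ∀ᶠ s φ ⟧ ρ = ∀ v → Elem s v → ⟦ φ ⟧ (v ∷ₑ ρ)
  ⟦ ∃ᶠ s φ ⟧ ρ = ¬ (∀ v → Elem s v → ¬ ⟦ φ ⟧ (v ∷ₑ ρ))

  stable : ∀ {Γ} (φ : Formula Γ) (ρ : Env Γ) → ¬ ¬ ⟦ φ ⟧ ρ → ⟦ φ ⟧ ρ
  stable ⊥ᶠ       ρ ¬¬a = ¬¬a (λ a → a)
  stable (t ≐ u)  ρ ¬¬a with eval t ρ ≟ᴹ eval u ρ
  ... | yes t≡u = t≡u
  ... | no  t≢u = ⊥-elim (¬¬a t≢u)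
  stable (φ ⇒ ψ)  ρ ¬¬f a = stable ψ ρ (λ ¬b → ¬¬f (λ f → ¬b (f a)))
  stable (φ ∧ᶠ ψ) ρ ¬¬p =
    stable φ ρ (λ ¬a → ¬¬p (¬a ∘ proj₁)) , stable ψ ρ (λ ¬b → ¬¬p (¬b ∘ proj₂))
  stable (φ ∨ᶠ ψ) ρ ¬¬p ¬q = ¬¬p (λ p → p ¬q)
  stable (∀ᶠ s φ) ρ ¬¬f v e = stable φ (v ∷ₑ ρ) (λ ¬a → ¬¬f (λ f → ¬a (f v e)))
  stable (∃ᶠ s φ) ρ ¬¬p ¬q = ¬¬p (λ p → p ¬q)

  ≡-cong-⇔ : ∀ {A : Set} {a a' b b' : A} → a ≡ a' → b ≡ b' → (a ≡ b) ⇔ (a' ≡ b')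
  ≡-cong-⇔ refl refl = ⇔-id _

  ∀-cong-⇔ : ∀ {s} {A B : Carrier s → Set} → (∀ v → A v ⇔ B v) →
             (∀ v → Elem s v → A v) ⇔ (∀ v → Elem s v → B v)
  ∀-cong-⇔ A⇔B = mk⇔ (λ f v e → to (A⇔B v) (f v e)) (λ f v e → from (A⇔B v) (f v e))

  liftR-eq : ∀ {Γ Δ s} {r : Ren Γ Δ} {ρ : Env Δ} {ρ' : Env Γ} (v : Carrier s) →
             (∀ {t} (x : Γ ∋ t) → ρ (r x) ≡ ρ' x) →
             ∀ {t} (x : s ∷ Γ ∋ t) → (v ∷ₑ ρ) (liftR r x) ≡ (v ∷ₑ ρ') x
  liftR-eq v eq here      = refl
  liftR-eq v eq (there x) = eq x

  eval-ren : ∀ {Γ Δ s} (r : Ren Γ Δ) (t : Term Γ s) {ρ : Env Δ} {ρ' : Env Γ} →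
             (∀ {s} (x : Γ ∋ s) → ρ (r x) ≡ ρ' x) → eval (renT r t) ρ ≡ eval t ρ'
  eval-ren r (var x)    eq = eq x
  eval-ren r nil        eq = refl
  eval-ren r (cons t T) eq = cong₂ consᴹ (eval-ren r t eq) (eval-ren r T eq)
  eval-ren r (T ⌢ U)    eq = cong₂ _⌢ᴹ_ (eval-ren r T eq) (eval-ren r U eq)

  ⟦⟧-ren : ∀ {Γ Δ} (r : Ren Γ Δ) (φ : Formula Γ) {ρ : Env Δ} {ρ' : Env Γ} →
           (∀ {s} (x : Γ ∋ s) → ρ (r x) ≡ ρ' x) → ⟦ renF r φ ⟧ ρ ⇔ ⟦ φ ⟧ ρ'
  ⟦⟧-ren r ⊥ᶠ       eq = ⇔-id _
  ⟦⟧-ren r (t ≐ u)  eq = ≡-cong-⇔ (eval-ren r t eq) (eval-ren r u eq)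
  ⟦⟧-ren r (φ ⇒ ψ)  eq = →-cong-⇔ (⟦⟧-ren r φ eq) (⟦⟧-ren r ψ eq)
  ⟦⟧-ren r (φ ∧ᶠ ψ) eq = ⟦⟧-ren r φ eq ×-⇔ ⟦⟧-ren r ψ eq
  ⟦⟧-ren r (φ ∨ᶠ ψ) eq = ¬-cong-⇔ (¬-cong-⇔ (⟦⟧-ren r φ eq ⊎-⇔ ⟦⟧-ren r ψ eq))
  ⟦⟧-ren r (∀ᶠ s φ) eq = ∀-cong-⇔ λ v → ⟦⟧-ren (liftR r) φ (liftR-eq v eq)
  ⟦⟧-ren r (∃ᶠ s φ) eq = ¬-cong-⇔ (∀-cong-⇔ λ v → ¬-cong-⇔ (⟦⟧-ren (liftR r) φ (liftR-eq v eq)))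

  liftS-eq : ∀ {Γ Δ s} {σ : Sub Γ Δ} {ρ : Env Δ} {ρ' : Env Γ} (v : Carrier s) →
             (∀ {t} (x : Γ ∋ t) → eval (σ x) ρ ≡ ρ' x) →
             ∀ {t} (x : s ∷ Γ ∋ t) → eval (liftS σ x) (v ∷ₑ ρ) ≡ (v ∷ₑ ρ') x
  liftS-eq         v eq here      = refl
  liftS-eq {σ = σ} v eq (there x) = trans (eval-ren there (σ x) λ _ → refl) (eq x)

  eval-sub : ∀ {Γ Δ s} (σ : Sub Γ Δ) (t : Term Γ s) {ρ : Env Δ} {ρ' : Env Γ} →
             (∀ {s} (x : Γ ∋ s) → eval (σ x) ρ ≡ ρ' x) → eval (subT σ t) ρ ≡ eval t ρ'
  eval-sub σ (var x)    eq = eq x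
  eval-sub σ nil        eq = refl
  eval-sub σ (cons t T) eq = cong₂ consᴹ (eval-sub σ t eq) (eval-sub σ T eq)
  eval-sub σ (T ⌢ U)    eq = cong₂ _⌢ᴹ_ (eval-sub σ T eq) (eval-sub σ U eq)

  ⟦⟧-sub : ∀ {Γ Δ} (σ : Sub Γ Δ) (φ : Formula Γ) {ρ : Env Δ} {ρ' : Env Γ} →
           (∀ {s} (x : Γ ∋ s) → eval (σ x) ρ ≡ ρ' x) → ⟦ subF σ φ ⟧ ρ ⇔ ⟦ φ ⟧ ρ'
  ⟦⟧-sub σ ⊥ᶠ       eq = ⇔-id _
  ⟦⟧-sub σ (t ≐ u)  eq = ≡-cong-⇔ (eval-sub σ t eq) (eval-sub σ u eq)
  ⟦⟧-sub σ (φ ⇒ ψ)  eq = →-cong-⇔ (⟦⟧-sub σ φ eq) (⟦⟧-sub σ ψ eq)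
  ⟦⟧-sub σ (φ ∧ᶠ ψ) eq = ⟦⟧-sub σ φ eq ×-⇔ ⟦⟧-sub σ ψ eq
  ⟦⟧-sub σ (φ ∨ᶠ ψ) eq = ¬-cong-⇔ (¬-cong-⇔ (⟦⟧-sub σ φ eq ⊎-⇔ ⟦⟧-sub σ ψ eq))
  ⟦⟧-sub σ (∀ᶠ s φ) eq = ∀-cong-⇔ λ v → ⟦⟧-sub (liftS σ) φ (liftS-eq v eq)
  ⟦⟧-sub σ (∃ᶠ s φ) eq = ¬-cong-⇔ (∀-cong-⇔ λ v → ¬-cong-⇔ (⟦⟧-sub (liftS σ) φ (liftS-eq v eq)))

  ⟦⟧-wk : ∀ {Γ s} (φ : Formula Γ) {v : Carrier s} {ρ : Env Γ} → ⟦ wk φ ⟧ (v ∷ₑ ρ) ⇔ ⟦ φ ⟧ ρ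
  ⟦⟧-wk φ = ⟦⟧-ren there φ λ _ → refl

  ⟦⟧-inst : ∀ {Γ s} (φ : Formula (s ∷ Γ)) (t : Term Γ s) {ρ : Env Γ} →
            ⟦ φ [ t ] ⟧ ρ ⇔ ⟦ φ ⟧ (eval t ρ ∷ₑ ρ)
  ⟦⟧-inst φ t = ⟦⟧-sub (sub0 t) φ λ { here → refl ; (there x) → refl }

  module Soundness {Ax : Formula [] → Set} (valid : ∀ {ψ} → Ax ψ → ⟦ ψ ⟧ ∅) where

    wk-hyps : ∀ {Γ s} {Hs : List (Formula Γ)} {v : Carrier s} {ρ : Env Γ} →
              All (λ h → ⟦ h ⟧ ρ) Hs → All (λ h → ⟦ h ⟧ (v ∷ₑ ρ)) (map wk Hs)
    wk-hyps H = map⁺ (All.map (from (⟦⟧-wk _)) H)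

    sound : ∀ {Γ Hs φ} → Deriv Ax Γ Hs φ →
            ∀ {ρ : Env Γ} → ElemEnv ρ → All (λ h → ⟦ h ⟧ ρ) Hs → ⟦ φ ⟧ ρ
    sound (ax {ψ = ψ} a)    E H = from (⟦⟧-ren closedToCtx ψ λ ()) (valid a)
    sound (hyp h∈Hs)        E H = All.lookup H h∈Hs
    sound (raa {φ = φ} d)   E H = stable φ _ λ ¬a → sound d E (¬a ∷ H)
    sound (⇒I d)            E H = λ a → sound d E (a ∷ H)
    sound (⇒E d e)          E H = sound d E H (sound e E H)
    sound (∧I d e)          E H = sound d E H , sound e E H
    sound (∧E₁ d)           E H = proj₁ (sound d E H)
    sound (∧E₂ d)           E H = proj₂ (sound d E H)
    sound (∨I₁ d)           E H = λ ¬p → ¬p (inj₁ (sound d E H))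
    sound (∨I₂ d)           E H = λ ¬p → ¬p (inj₂ (sound d E H))
    sound (∨E {χ = χ} d e f) E H = stable χ _ λ ¬c → sound d E H λ
      { (inj₁ a) → ¬c (sound e E (a ∷ H))
      ; (inj₂ b) → ¬c (sound f E (b ∷ H)) }
    sound (∀I d)            E H = λ v e → sound d (∷ₑ-elem e E) (wk-hyps H)
    sound (∀E {φ = φ} d t)  E H = from (⟦⟧-inst φ t) (sound d E H _ (eval-elem t E))
    sound (∃I {φ = φ} t d)  E H = λ ¬p → ¬p _ (eval-elem t E) (to (⟦⟧-inst φ t) (sound d E H))
    sound (∃E {ψ = ψ} d e)  E H = stable ψ _ λ ¬c → sound d E H λ v e' a →
      ¬c (to (⟦⟧-wk ψ) (sound e (∷ₑ-elem e' E) (a ∷ wk-hyps H)))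
    sound (≐I t)            E H = refl
    sound (≐E {t = t} {u} φ d e) E H =
      from (⟦⟧-inst φ u) (subst (λ v → ⟦ φ ⟧ (v ∷ₑ _)) (sound d E H) (to (⟦⟧-inst φ t) (sound e E H)))
    sound (nonempty {φ = φ} s d) E H =
      to (⟦⟧-wk φ) (sound d (∷ₑ-elem (proj₂ (witness s)) E) (wk-hyps {v = proj₁ (witness s)} H))

    ⊢-sound : ∀ {φ} → Ax ⊢ φ → ⟦ φ ⟧ ∅
    ⊢-sound d = sound d (λ ()) []

  ⟦close⟧ : ∀ Δ (ψ : Formula Δ) → (∀ (ρ : Env Δ) → ElemEnv ρ → ⟦ ψ ⟧ ρ) → ⟦ close Δ ψ ⟧ ∅
  ⟦close⟧ []      ψ valid = valid ∅ λ ()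
  ⟦close⟧ (s ∷ Δ) ψ valid = ⟦close⟧ Δ (∀ᶠ s ψ) λ ρ E v e → valid (v ∷ₑ ρ) (∷ₑ-elem e E)

  qf-⇔ : ∀ {Γ} {φ : Formula Γ} {ρ ρ' : Env Γ} → QF φ →
         (∀ {s} (t u : Term Γ s) → ⟦ t ≐ u ⟧ ρ ⇔ ⟦ t ≐ u ⟧ ρ') → ⟦ φ ⟧ ρ ⇔ ⟦ φ ⟧ ρ'
  qf-⇔ qf⊥                  atoms = ⇔-id _
  qf-⇔ (qf≐ {t = t} {u})    atoms = atoms t u
  qf-⇔ (qf⇒ φ ψ) atoms = →-cong-⇔ (qf-⇔ φ atoms) (qf-⇔ ψ atoms)
  qf-⇔ (qf∧ φ ψ) atoms = qf-⇔ φ atoms ×-⇔ qf-⇔ ψ atoms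
  qf-⇔ (qf∨ φ ψ) atoms = ¬-cong-⇔ (¬-cong-⇔ (qf-⇔ φ atoms ⊎-⇔ qf-⇔ ψ atoms))

  record PartialHom : Set₁ where
    field
      hom      : ∀ {s} → Carrier s → Carrier s
      Dom      : ∀ {s} → Carrier s → Set
      nil-dom  : Dom nilᴹ
      cons-dom : ∀ {x X} → Dom x → Dom X → Dom (consᴹ x X)
      ⌢-dom    : ∀ {X Y} → Dom X → Dom Y → Dom (X ⌢ᴹ Y)
      hom-nil  : hom nilᴹ ≡ nilᴹ
      hom-cons : ∀ {x X} → Dom x → Dom X → hom (consᴹ x X) ≡ consᴹ (hom x) (hom X)
      hom-⌢    : ∀ {X Y} → Dom X → Dom Y → hom (X ⌢ᴹ Y) ≡ hom X ⌢ᴹ hom Y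

    DomEnv : ∀ {Γ} → Env Γ → Set
    DomEnv {Γ} ρ = ∀ {s} (x : Γ ∋ s) → Dom (ρ x)

    eval-dom : ∀ {Γ s} (t : Term Γ s) {ρ : Env Γ} → DomEnv ρ → Dom (eval t ρ)
    eval-dom (var x)    D = D x
    eval-dom nil        D = nil-dom
    eval-dom (cons t T) D = cons-dom (eval-dom t D) (eval-dom T D)
    eval-dom (T ⌢ U)    D = ⌢-dom (eval-dom T D) (eval-dom U D)

    eval-hom : ∀ {Γ s} (t : Term Γ s) {ρ ρ' : Env Γ} → DomEnv ρ →
               (∀ {s} (x : Γ ∋ s) → hom (ρ x) ≡ ρ' x) → hom (eval t ρ) ≡ eval t ρ'
    eval-hom (var x)    D eq = eq x
    eval-hom nil        D eq = hom-nil
    eval-hom (cons t T) D eq =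
      trans (hom-cons (eval-dom t D) (eval-dom T D)) (cong₂ consᴹ (eval-hom t D eq) (eval-hom T D eq))
    eval-hom (T ⌢ U)    D eq =
      trans (hom-⌢ (eval-dom T D) (eval-dom U D)) (cong₂ _⌢ᴹ_ (eval-hom T D eq) (eval-hom U D eq))

    atom-hom : ∀ {Γ s} (t u : Term Γ s) {ρ ρ' : Env Γ} → DomEnv ρ →
               (∀ {s} (x : Γ ∋ s) → hom (ρ x) ≡ ρ' x) → ⟦ t ≐ u ⟧ ρ → ⟦ t ≐ u ⟧ ρ'
    atom-hom t u D eq t≡u = trans (sym (eval-hom t D eq)) (trans (cong hom t≡u) (eval-hom u D eq))

  open PartialHom using (hom; DomEnv; atom-hom)

  qf-hom-⇔ : ∀ {Γ} {φ : Formula Γ} {ρ ρ' : Env Γ} → QF φ → (f g : PartialHom) →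
             DomEnv f ρ → DomEnv g ρ' →
             (∀ {s} (x : Γ ∋ s) → hom f (ρ x) ≡ ρ' x) → (∀ {s} (x : Γ ∋ s) → hom g (ρ' x) ≡ ρ x) →
             ⟦ φ ⟧ ρ ⇔ ⟦ φ ⟧ ρ'
  qf-hom-⇔ φ f g Df Dg f-eq g-eq =
    qf-⇔ φ λ t u → mk⇔ (atom-hom f t u Df f-eq) (atom-hom g t u Dg g-eq)

  extᵢ : ∀ {Γ} (xs : List (Carrier ι)) → Env Γ → Env (iCtx (length xs) Γ)
  extᵢ []       ρ = ρ
  extᵢ (x ∷ xs) ρ = x ∷ₑ extᵢ xs ρ

  ⟦∀ι*⟧ : ∀ {Γ} (xs : List (Carrier ι)) (ψ : Formula (iCtx (length xs) Γ)) {ρ : Env Γ} →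
          All (Elem ι) xs → ⟦ ∀ι* (length xs) ψ ⟧ ρ → ⟦ ψ ⟧ (extᵢ xs ρ)
  ⟦∀ι*⟧ []       ψ []       a = a
  ⟦∀ι*⟧ (x ∷ xs) ψ (e ∷ es) a = ⟦∀ι*⟧ xs (∀ᶠ ι ψ) es a x e

  extᵢ-wkN : ∀ {Γ} (xs : List (Carrier ι)) (ρ : Env Γ) {s} (x : Γ ∋ s) →
             extᵢ xs ρ (wkN (length xs) x) ≡ ρ x
  extᵢ-wkN []       ρ x = refl
  extᵢ-wkN (_ ∷ xs) ρ x = extᵢ-wkN xs ρ x

  -- vars lists x₁, …, x_k with x_k innermost, while extᵢ binds the head of its list innermost.
  eval-vars : ∀ {Γ} (xs : List (Carrier ι)) (ρ : Env Γ) →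
              map (λ t → eval t (extᵢ xs ρ)) (vars (length xs)) ≡ reverse xs
  eval-vars []       ρ = refl
  eval-vars (x ∷ xs) ρ = begin
    map ev (map (renT there) (vars k) ++ var here ∷ [])  ≡⟨ Listₚ.map-++ ev (map (renT there) (vars k)) _ ⟩
    map ev (map (renT there) (vars k)) ∷ʳ x              ≡⟨ cong (_∷ʳ x) (Listₚ.map-∘ (vars k)) ⟨
    map (ev ∘ renT there) (vars k) ∷ʳ x                  ≡⟨ cong (_∷ʳ x) (Listₚ.map-cong (λ t → eval-ren there t λ _ → refl) (vars k)) ⟩
    map (λ t → eval t (extᵢ xs ρ)) (vars k) ∷ʳ x         ≡⟨ cong (_∷ʳ x) (eval-vars xs ρ) ⟩
    reverse xs ∷ʳ x                                      ≡⟨ Listₚ.unfold-reverse x xs ⟨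
    reverse (x ∷ xs)                                     ∎
    where
    open ≡-Reasoning
    k = length xs
    ev : Term (ι ∷ iCtx k _) ι → Carrier ι
    ev t = eval t (extᵢ (x ∷ xs) ρ)

  eval-consL : ∀ {Γ} (ts : List (Term Γ ι)) (T : Term Γ lst) (ρ : Env Γ) →
               eval (consL ts T) ρ ≡ consᴹ* (map (λ t → eval t ρ) ts) (eval T ρ)
  eval-consL []       T ρ = refl
  eval-consL (t ∷ ts) T ρ = cong (consᴹ (eval t ρ)) (eval-consL ts T ρ)

  record InductionPremises (P : Carrier lst → Set) (n : ℕ) : Set where
    field
      base : ∀ xs → All (Elem ι) xs → length xs ≤ n → P (consᴹ* xs nilᴹ)
      step : ∀ xs → All (Elem ι) xs → length xs ≡ suc n →
             ∀ X → Elem lst X → P X → P (consᴹ* xs X)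

  module _ {Δ : Ctx} (φ : Formula (lst ∷ Δ)) (η : Env Δ) where

    private
      P : Carrier lst → Set
      P X = ⟦ φ ⟧ (X ∷ₑ η)

    ⟦baseCase⟧ : ∀ xs → All (Elem ι) xs → ⟦ baseCase φ (length xs) ⟧ η →
                 P (consᴹ* (reverse xs) nilᴹ)
    ⟦baseCase⟧ xs es a = to (⟦⟧-sub (instX k T) φ inst-eq) (⟦∀ι*⟧ xs _ es a)
      where
      k = length xs
      T = consL (vars k) nil
      inst-eq : ∀ {s} (x : lst ∷ Δ ∋ s) →
                eval (instX k T x) (extᵢ xs η) ≡ (consᴹ* (reverse xs) nilᴹ ∷ₑ η) x
      inst-eq here      = trans (eval-consL (vars k) nil _) (cong (λ ys → consᴹ* ys nilᴹ) (eval-vars xs η))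
      inst-eq (there x) = extᵢ-wkN xs η x

    ⟦stepCase⟧ : ∀ xs → All (Elem ι) xs → ⟦ stepCase φ (length xs) ⟧ η →
                 ∀ X → Elem lst X → P X → P (consᴹ* (reverse xs) X)
    ⟦stepCase⟧ xs es a X e pX =
      to (⟦⟧-ren (liftR there) φ shift-eq)
        (to (⟦⟧-sub (instX k T) _ inst-eq)
          (⟦∀ι*⟧ xs _ es (a X e) (from (⟦⟧-ren (wkN k) φ (extᵢ-wkN xs (X ∷ₑ η))) pX)))
      where
      k = length xs
      T = consL (vars k) (var (wkN k here))
      Y = consᴹ* (reverse xs) X
      inst-eq : ∀ {s} (x : lst ∷ lst ∷ Δ ∋ s) →
                eval (instX k T x) (extᵢ xs (X ∷ₑ η)) ≡ (Y ∷ₑ X ∷ₑ η) x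
      inst-eq here      = trans (eval-consL (vars k) _ _)
                                (cong₂ consᴹ* (eval-vars xs (X ∷ₑ η)) (extᵢ-wkN xs (X ∷ₑ η) here))
      inst-eq (there x) = extᵢ-wkN xs (X ∷ₑ η) x
      shift-eq : ∀ {s} (x : lst ∷ Δ ∋ s) → (Y ∷ₑ X ∷ₑ η) (liftR there x) ≡ (Y ∷ₑ η) x
      shift-eq here      = refl
      shift-eq (there x) = refl

    ⟦baseCases⟧ : ∀ {n k} → k ≤ n → ⟦ baseCases φ n ⟧ η → ⟦ baseCase φ k ⟧ η
    ⟦baseCases⟧ {zero}  k≤0   a       rewrite n≤0⇒n≡0 k≤0 = a
    ⟦baseCases⟧ {suc n} k≤1+n (a , b) with m≤n⇒m<n∨m≡n k≤1+n
    ... | inj₁ k<1+n = ⟦baseCases⟧ (≤-pred k<1+n) a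
    ... | inj₂ refl  = b

    ⟦Ind-premises⟧ : ∀ n → ⟦ baseCases φ n ∧ᶠ stepCase φ (suc n) ⟧ η → InductionPremises P n
    ⟦Ind-premises⟧ n (bs , st) = record
      { base = λ xs es len → unreverse (λ ys → P (consᴹ* ys nilᴹ)) xs
          (⟦baseCase⟧ (reverse xs) (All-reverse es)
            (⟦baseCases⟧ (≤-trans (≤-reflexive (Listₚ.length-reverse xs)) len) bs))
      ; step = λ xs es len X e pX → unreverse (λ ys → P (consᴹ* ys X)) xs
          (⟦stepCase⟧ (reverse xs) (All-reverse es)
            (subst (λ k → ⟦ stepCase φ k ⟧ η) (sym (trans (Listₚ.length-reverse xs) len)) st) X e pX)
      }
      where
      unreverse : (Q : List (Carrier ι) → Set) (xs : List (Carrier ι)) → Q (reverse (reverse xs)) → Q xs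
      unreverse Q xs = subst Q (Listₚ.reverse-involutive xs)

data Kind : Set where
  S W : Kind

data Sym : Set where
  L   : ℕ → Sym
  tok : Kind → ℕ → Sym

idx : Sym → ℕ
idx (L k)     = k
idx (tok _ k) = k

fuse : Sym → Sym → Maybe Sym
fuse (L k)     (tok κ (suc j)) with k ≟ j
... | yes _ = just (tok κ k)
... | no  _ = nothing
fuse (tok S k) (tok W zero)    = just (tok W k)
fuse _         _               = nothing

data Fuses : Sym → Sym → Sym → Set where
  absorb : ∀ κ k → Fuses (L k) (tok κ (suc k)) (tok κ k)
  attach : ∀ k → Fuses (tok S k) (tok W 0) (tok W k)

Fuses⇒fuse : ∀ {x y z} → Fuses x y z → fuse x y ≡ just z
Fuses⇒fuse (absorb κ k) with k ≟ k
... | yes _   = refl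
... | no  k≢k = ⊥-elim (k≢k refl)
Fuses⇒fuse (attach k)   = refl

fuse⇒Fuses : ∀ x y {z} → fuse x y ≡ just z → Fuses x y z
fuse⇒Fuses (L k)     (tok κ (suc j)) eq with k ≟ j | eq
... | yes refl | refl = absorb κ k
... | no _     | ()
fuse⇒Fuses (tok S k) (tok W zero)    refl = attach k
fuse⇒Fuses (L _)     (L _)           ()
fuse⇒Fuses (L _)     (tok _ zero)    ()
fuse⇒Fuses (tok S _) (L _)           ()
fuse⇒Fuses (tok S _) (tok S _)       ()
fuse⇒Fuses (tok S _) (tok W (suc _)) ()
fuse⇒Fuses (tok W _) _               ()

push : Sym → List Sym → List Sym
push x []      = x ∷ []
push x (y ∷ w) = maybe′ (_∷ w) (x ∷ y ∷ w) (fuse x y)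

append : List Sym → List Sym → List Sym
append u w = foldr push w u

data PushView (x : Sym) : List Sym → Set where
  empty : PushView x []
  stuck : ∀ {y w} → fuse x y ≡ nothing → PushView x (y ∷ w)
  fused : ∀ {y z w} → Fuses x y z → PushView x (y ∷ w)

push-view : ∀ x w → PushView x w
push-view x []      = empty
push-view x (y ∷ w) with fuse x y in eq
... | nothing = stuck eq
... | just z  = fused (fuse⇒Fuses x y eq)

push-stuck : ∀ x y w → fuse x y ≡ nothing → push x (y ∷ w) ≡ x ∷ y ∷ w
push-stuck x y w eq = cong (maybe′ (_∷ w) (x ∷ y ∷ w)) eq

push-fused : ∀ {x y z} w → Fuses x y z → push x (y ∷ w) ≡ z ∷ w
push-fused {x} {y} w F = cong (maybe′ (_∷ w) (x ∷ y ∷ w)) (Fuses⇒fuse F)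

push-W : ∀ k w → push (tok W k) w ≡ tok W k ∷ w
push-W k []      = refl
push-W k (_ ∷ _) = refl

fuse-reindex : ∀ κ {j} k y → fuse (tok κ j) y ≡ nothing → fuse (tok κ k) y ≡ nothing
fuse-reindex W k y               eq = refl
fuse-reindex S k (L _)           eq = refl
fuse-reindex S k (tok S _)       eq = refl
fuse-reindex S k (tok W (suc _)) eq = refl

push-fuse : ∀ {x y z} → Fuses x y z → ∀ w → push x (push y w) ≡ push z w
push-fuse (absorb W k) w rewrite push-W (suc k) w | push-fused w (absorb W k) = sym (push-W k w)
push-fuse (absorb S k) w with push-view (tok S (suc k)) w
... | empty = push-fused [] (absorb S k)
... | stuck {y} {w'} eq = begin
  push (L k) (push (tok S (suc k)) (y ∷ w'))  ≡⟨ cong (push (L k)) (push-stuck (tok S (suc k)) y w' eq) ⟩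
  push (L k) (tok S (suc k) ∷ y ∷ w')         ≡⟨ push-fused (y ∷ w') (absorb S k) ⟩
  tok S k ∷ y ∷ w'                            ≡⟨ push-stuck (tok S k) y w' (fuse-reindex S k y eq) ⟨
  push (tok S k) (y ∷ w')                     ∎
  where open ≡-Reasoning
... | fused (attach _) = push-fused _ (absorb W k)
push-fuse (attach k) w rewrite push-W 0 w = sym (push-W k w)

Normal : List Sym → Set
Normal = Linked (λ x y → fuse x y ≡ nothing)

Normal-reindex : ∀ κ {j} k {w} → Normal (tok κ j ∷ w) → Normal (tok κ k ∷ w)
Normal-reindex κ k [-]     = [-]
Normal-reindex κ k (e ∷ n) = fuse-reindex κ k _ e ∷ n

push-normal : ∀ x {w} → Normal w → Normal (push x w)
push-normal x {w} nw with push-view x w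
... | empty                         = [-]
... | stuck {y} {w'} e              = subst Normal (sym (push-stuck x y w' e)) (e ∷ nw)
... | fused {w = w'} F@(absorb κ k) = subst Normal (sym (push-fused w' F)) (Normal-reindex κ k nw)
... | fused {w = w'} F@(attach k)   = subst Normal (sym (push-fused w' F)) (Normal-reindex W k nw)

push-normal-head : ∀ {x w} → Normal (x ∷ w) → push x w ≡ x ∷ w
push-normal-head [-]     = refl
push-normal-head (e ∷ _) = push-stuck _ _ _ e

append-normal : ∀ u {w} → Normal w → Normal (append u w)
append-normal []      nw = nw
append-normal (x ∷ u) nw = push-normal x (append-normal u nw)

append-push : ∀ x u w → append (push x u) w ≡ push x (append u w)
append-push x u w with push-view x u
... | empty              = refl
... | stuck {y} {u'} e   = cong (λ v → append v w) (push-stuck x y u' e)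
... | fused {w = u'} F   = trans (cong (λ v → append v w) (push-fused u' F)) (sym (push-fuse F (append u' w)))

append-assoc : ∀ u v w → append (append u v) w ≡ append u (append v w)
append-assoc []      v w = refl
append-assoc (x ∷ u) v w = trans (append-push x (append u v) w) (cong (push x) (append-assoc u v w))

-- A left inverse of cons, also when a token has absorbed the letter.
uncons : List Sym → ℕ × List Sym
uncons []            = 0 , []
uncons (L k ∷ w)     = k , w
uncons (tok κ k ∷ w) = k , tok κ (suc k) ∷ w

uncons-push : ∀ k w → uncons (push (L k) w) ≡ (k , w)
uncons-push k w with push-view (L k) w
... | empty                         = refl
... | stuck {y} {w'} e              = cong uncons (push-stuck (L k) y w' e)
... | fused {w = w'} F@(absorb κ k) = cong uncons (push-fused w' F)

push-≢-[] : ∀ x w → push x w ≢ []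
push-≢-[] x []      ()
push-≢-[] x (y ∷ w) eq with fuse x y
push-≢-[] x (y ∷ w) () | just _
push-≢-[] x (y ∷ w) () | nothing

_≟ᴷ_ : DecidableEquality Kind
S ≟ᴷ S = yes refl
W ≟ᴷ W = yes refl
S ≟ᴷ W = no λ ()
W ≟ᴷ S = no λ ()

_≟ˢ_ : DecidableEquality Sym
L j     ≟ˢ L k      = map′ (cong L) (λ { refl → refl }) (j ≟ k)
tok κ j ≟ˢ tok κ' k with κ ≟ᴷ κ' | j ≟ k
... | yes refl | yes refl = yes refl
... | no  κ≢κ' | _        = no λ { refl → κ≢κ' refl }
... | _        | no  j≢k  = no λ { refl → j≢k refl }
L _     ≟ˢ tok _ _  = no λ ()
tok _ _ ≟ˢ L _      = no λ ()

Val : Sort → Set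
Val ι   = ℕ
Val lst = List Sym

ValElem : ∀ s → Val s → Set
ValElem ι   _ = ⊤
ValElem lst w = Normal w

model : Structure
model = record
  { Carrier   = Val
  ; Elem      = ValElem
  ; _≟ᴹ_      = λ {s} → dec s
  ; witness   = λ { ι → 0 , tt ; lst → [] , [] }
  ; nilᴹ      = []
  ; consᴹ     = λ k w → push (L k) w
  ; _⌢ᴹ_      = append
  ; nil-elem  = []
  ; cons-elem = λ _ → push-normal _
  ; ⌢-elem    = λ {u} _ → append-normal u
  }
  where
  dec : ∀ s → DecidableEquality (Val s)
  dec ι   = _≟_
  dec lst = Listₚ.≡-dec _≟ˢ_

open Structure model using (consᴹ*)
open Semantics model

Below : ℕ → List Sym → Set
Below B = All (λ x → idx x < B)

Small : ℕ → ∀ s → Val s → Set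
Small B ι   k = k < B
Small B lst w = Below B w

fuse-L-below : ∀ {B y} → idx y < B → fuse (L B) y ≡ nothing
fuse-L-below {y = L _}           _ = refl
fuse-L-below {y = tok κ zero}    _ = refl
fuse-L-below {B} {tok κ (suc j)} p with B ≟ j
... | yes refl = ⊥-elim (<-irrefl refl (<-trans (n<1+n B) p))
... | no  _    = refl

Normal-L∷ : ∀ {B w} → Below B w → Normal w → Normal (L B ∷ w)
Normal-L∷ []                  _  = [-]
Normal-L∷ {w = y ∷ _} (p ∷ _) nw = fuse-L-below {y = y} p ∷ nw

fuse-image-fixed : ∀ (image : Sym → List Sym) {x y z} →
                   image x ≡ x ∷ [] → image y ≡ y ∷ [] → image z ≡ z ∷ [] → Fuses x y z →
                   ∀ w → append (image z) w ≡ append (image x) (append (image y) w)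
fuse-image-fixed image ix iy iz F w rewrite ix | iy | iz = sym (push-fuse F w)

record SymbolSubst (B : ℕ) : Set₁ where
  field
    image       : Sym → List Sym
    Dom         : Sym → Set
    below-dom   : ∀ {x} → idx x < B → Dom x
    image-below : ∀ {x} → idx x < B → image x ≡ x ∷ []
    fuse-dom    : ∀ {x y z} → Dom x → Dom y → Fuses x y z → Dom z
    fuse-image  : ∀ {x y z} → Dom x → Dom y → Fuses x y z →
                  ∀ w → append (image z) w ≡ append (image x) (append (image y) w)

  substᴸ : List Sym → List Sym
  substᴸ = foldr (λ x → append (image x)) []

  push-dom : ∀ {x w} → Dom x → All Dom w → All Dom (push x w)
  push-dom {x} {w} dx dw with push-view x w
  ... | empty            = dx ∷ []
  ... | stuck {y} {w'} e = subst (All Dom) (sym (push-stuck x y w' e)) (dx ∷ dw)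
  ... | fused {w = w'} F =
    subst (All Dom) (sym (push-fused w' F)) (fuse-dom dx (All.head dw) F ∷ All.tail dw)

  append-dom : ∀ {u w} → All Dom u → All Dom w → All Dom (append u w)
  append-dom []        dw = dw
  append-dom (dx ∷ du) dw = push-dom dx (append-dom du dw)

  substᴸ-push : ∀ {x w} → Dom x → All Dom w → substᴸ (push x w) ≡ append (image x) (substᴸ w)
  substᴸ-push {x} {w} dx dw with push-view x w
  ... | empty            = refl
  ... | stuck {y} {w'} e = cong substᴸ (push-stuck x y w' e)
  ... | fused {w = w'} F =
    trans (cong substᴸ (push-fused w' F)) (fuse-image dx (All.head dw) F (substᴸ w'))

  substᴸ-append : ∀ {u w} → All Dom u → All Dom w → substᴸ (append u w) ≡ append (substᴸ u) (substᴸ w)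
  substᴸ-append             []        dw = refl
  substᴸ-append {x ∷ u} {w} (dx ∷ du) dw = begin
    substᴸ (push x (append u w))                      ≡⟨ substᴸ-push dx (append-dom du dw) ⟩
    append (image x) (substᴸ (append u w))            ≡⟨ cong (append (image x)) (substᴸ-append du dw) ⟩
    append (image x) (append (substᴸ u) (substᴸ w))   ≡⟨ append-assoc (image x) (substᴸ u) (substᴸ w) ⟨
    append (append (image x) (substᴸ u)) (substᴸ w)   ∎
    where open ≡-Reasoning

  substᴸ-below : ∀ {w} → Below B w → Normal w → substᴸ w ≡ w
  substᴸ-below []            _  = refl
  substᴸ-below {x ∷ w} (p ∷ ps) nw =
    trans (cong₂ append (image-below p) (substᴸ-below ps (Linked.tail nw))) (push-normal-head nw)

  partialHom : PartialHom
  partialHom = record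
    { hom      = λ {s} → hom s
    ; Dom      = λ {s} → DomV s
    ; nil-dom  = []
    ; cons-dom = λ p dw → push-dom (below-dom p) dw
    ; ⌢-dom    = append-dom
    ; hom-nil  = refl
    ; hom-cons = λ {_} {X} p dw →
        trans (substᴸ-push (below-dom p) dw) (cong (λ v → append v (substᴸ X)) (image-below p))
    ; hom-⌢    = substᴸ-append
    }
    where
    hom : ∀ s → Val s → Val s
    hom ι   = id
    hom lst = substᴸ
    DomV : ∀ s → Val s → Set
    DomV ι   k = k < B
    DomV lst w = All Dom w

  module _ {Δ} {η : Env Δ} (small : ∀ {s} (x : Δ ∋ s) → Small B s (η x)) where
    open PartialHom partialHom using (DomEnv) renaming (hom to homᴾ)

    ∷ₑ-dom : ∀ {v} → All Dom v → DomEnv (v ∷ₑ η)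
    ∷ₑ-dom dv here            = dv
    ∷ₑ-dom dv {ι}   (there x) = small x
    ∷ₑ-dom dv {lst} (there x) = All.map below-dom (small x)

    ∷ₑ-hom : ElemEnv η → ∀ {v v'} → substᴸ v ≡ v' →
             ∀ {s} (x : lst ∷ Δ ∋ s) → homᴾ ((v ∷ₑ η) x) ≡ (v' ∷ₑ η) x
    ∷ₑ-hom elems eq here            = eq
    ∷ₑ-hom elems eq {ι}   (there x) = refl
    ∷ₑ-hom elems eq {lst} (there x) = substᴸ-below (small x) (elems x)

module Swap (B i : ℕ) (B<i : B < i) where

  below-≢ : ∀ {k} → k < B → k ≢ i
  below-≢ k<B = <⇒≢ (<-trans k<B B<i)

  0≢i : 0 ≢ i
  0≢i = <⇒≢ (≤-<-trans z≤n B<i)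

  suc-≢ : ∀ {k} → k < B → suc k ≢ i
  suc-≢ k<B refl = <-irrefl refl (≤-<-trans k<B B<i)

  -- The image of tok κ i when the distinguished token is tok κ₀ i.
  tokenImage : Kind → Kind → List Sym
  tokenImage _ S = L B ∷ []
  tokenImage S W = L B ∷ tok W 0 ∷ []
  tokenImage W W = L B ∷ []

  imageD : Kind → Sym → List Sym
  imageD κ₀ (L k) = L k ∷ []
  imageD κ₀ (tok κ k) with k ≟ i
  ... | yes _ = tokenImage κ₀ κ
  ... | no  _ = tok κ k ∷ []

  imageD-≢ : ∀ κ₀ κ {k} → k ≢ i → imageD κ₀ (tok κ k) ≡ tok κ k ∷ []
  imageD-≢ κ₀ κ {k} k≢i with k ≟ i
  ... | yes k≡i = ⊥-elim (k≢i k≡i)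
  ... | no  _   = refl

  imageD-i : ∀ κ₀ κ → imageD κ₀ (tok κ i) ≡ tokenImage κ₀ κ
  imageD-i κ₀ κ with i ≟ i
  ... | yes _   = refl
  ... | no  i≢i = ⊥-elim (i≢i refl)

  imageD-below : ∀ κ₀ {x} → idx x < B → imageD κ₀ x ≡ x ∷ []
  imageD-below κ₀ {L k}     _   = refl
  imageD-below κ₀ {tok κ k} k<B = imageD-≢ κ₀ κ (below-≢ k<B)

  -- W i belongs to the domain as well, since S i · W 0 fuses into it.
  data DomD (κ₀ : Kind) : Sym → Set where
    below : ∀ {x} → idx x < B → DomD κ₀ x
    token : ∀ {κ k} → κ ≡ κ₀ ⊎ κ ≡ W → k ≡ i → DomD κ₀ (tok κ k)

  fuse-domD : ∀ {κ₀ x y z} → DomD κ₀ x → DomD κ₀ y → Fuses x y z → DomD κ₀ z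
  fuse-domD (below p)   _ (absorb κ k) = below p
  fuse-domD (below p)   _ (attach k)   = below p
  fuse-domD (token _ e) _ (attach k)   = token (inj₂ refl) e

  fuse-imageD : ∀ {κ₀ x y z} → DomD κ₀ x → DomD κ₀ y → Fuses x y z →
                ∀ w → append (imageD κ₀ z) w ≡ append (imageD κ₀ x) (append (imageD κ₀ y) w)
  fuse-imageD {κ₀} (below p) (below q) F@(absorb κ k) =
    fuse-image-fixed (imageD κ₀) refl (imageD-below κ₀ q) (imageD-below κ₀ p) F
  fuse-imageD (below p) (token _ e) (absorb κ k) = ⊥-elim (suc-≢ p e)
  fuse-imageD {κ₀} (below p) _ F@(attach k) =
    fuse-image-fixed (imageD κ₀) (imageD-below κ₀ p) (imageD-≢ κ₀ W 0≢i) (imageD-below κ₀ p) F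
  fuse-imageD {S} (token (inj₁ refl) refl) _ (attach _) w
    rewrite imageD-i S S | imageD-i S W | imageD-≢ S W 0≢i = refl
  fuse-imageD (token (inj₂ ()) _) _ (attach _)

  substD : Kind → SymbolSubst B
  substD κ₀ = record
    { image       = imageD κ₀
    ; Dom         = DomD κ₀
    ; below-dom   = below
    ; image-below = imageD-below κ₀
    ; fuse-dom    = fuse-domD
    ; fuse-image  = fuse-imageD
    }

  imageE : Kind → Sym → List Sym
  imageE κ₀ (L k) with k ≟ B
  ... | yes _ = tok κ₀ i ∷ []
  ... | no  _ = L k ∷ []
  imageE κ₀ (tok κ k) = tok κ k ∷ []

  imageE-below : ∀ κ₀ {x} → idx x < B → imageE κ₀ x ≡ x ∷ []
  imageE-below κ₀ {L k} k<B with k ≟ B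
  ... | yes k≡B = ⊥-elim (<⇒≢ k<B k≡B)
  ... | no  _   = refl
  imageE-below κ₀ {tok κ k} _ = refl

  imageE-B : ∀ κ₀ → imageE κ₀ (L B) ≡ tok κ₀ i ∷ []
  imageE-B κ₀ with B ≟ B
  ... | yes _   = refl
  ... | no  B≢B = ⊥-elim (B≢B refl)

  data DomE : Sym → Set where
    below  : ∀ {x} → idx x < B → DomE x
    letter : ∀ {k} → k ≡ B → DomE (L k)

  fuse-domE : ∀ {x y z} → DomE x → DomE y → Fuses x y z → DomE z
  fuse-domE (below p)  _         (absorb κ k) = below p
  fuse-domE (letter e) (below q) (absorb κ k) = ⊥-elim (<-irrefl e (<-trans (n<1+n k) q))
  fuse-domE (below p)  _         (attach k)   = below p

  fuse-imageE : ∀ {κ₀ x y z} → DomE x → DomE y → Fuses x y z →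
                ∀ w → append (imageE κ₀ z) w ≡ append (imageE κ₀ x) (append (imageE κ₀ y) w)
  fuse-imageE {κ₀} (below p) _ F@(absorb κ k) = fuse-image-fixed (imageE κ₀) (imageE-below κ₀ p) refl refl F
  fuse-imageE (letter e) (below q) (absorb κ k) = ⊥-elim (<-irrefl e (<-trans (n<1+n k) q))
  fuse-imageE {κ₀} _ _ F@(attach k) = fuse-image-fixed (imageE κ₀) refl refl refl F

  substE : Kind → SymbolSubst B
  substE κ₀ = record
    { image       = imageE κ₀
    ; Dom         = DomE
    ; below-dom   = below
    ; image-below = imageE-below κ₀
    ; fuse-dom    = fuse-domE
    ; fuse-image  = fuse-imageE
    }

  tokenImage-self : ∀ κ → tokenImage κ κ ≡ L B ∷ []
  tokenImage-self S = refl
  tokenImage-self W = refl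

  module _ {Δ} {φ : Formula (lst ∷ Δ)} (qf : QF φ) {η : Env Δ} (elems : ElemEnv η)
           (small : ∀ {s} (x : Δ ∋ s) → Small B s (η x)) where
    open SymbolSubst using (substᴸ; substᴸ-below; partialHom; ∷ₑ-dom; ∷ₑ-hom)

    -- D turns the token into the fresh letter L B and E turns it back; both fix r and η.
    swap : ∀ κ {r} → Below B r → Normal (tok κ i ∷ r) →
           ⟦ φ ⟧ ((L B ∷ r) ∷ₑ η) → ⟦ φ ⟧ ((tok κ i ∷ r) ∷ₑ η)
    swap κ {r} r<B nr = from (qf-hom-⇔ qf (partialHom D) (partialHom E)
                               (∷ₑ-dom D small (token (inj₁ refl) refl ∷ All.map below r<B))
                               (∷ₑ-dom E small (letter refl ∷ All.map below r<B))
                               (∷ₑ-hom D small elems D-eq) (∷ₑ-hom E small elems E-eq))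
      where
      D = substD κ
      E = substE κ
      nr' = Linked.tail nr
      D-eq : substᴸ D (tok κ i ∷ r) ≡ L B ∷ r
      D-eq rewrite imageD-i κ κ | tokenImage-self κ | substᴸ-below D r<B nr' =
        push-normal-head (Normal-L∷ r<B nr')
      E-eq : substᴸ E (L B ∷ r) ≡ tok κ i ∷ r
      E-eq rewrite imageE-B κ | substᴸ-below E r<B nr' = push-normal-head nr

splitAt-length : ∀ {A : Set} k (xs : List A) {l} → length xs ≡ k + l →
                 Σ[ ys ∈ List A ] Σ[ zs ∈ List A ] xs ≡ ys ++ zs × length ys ≡ k × length zs ≡ l
splitAt-length zero    xs       eq = [] , xs , refl , refl , eq
splitAt-length (suc k) (x ∷ xs) eq with splitAt-length k xs (suc-injective eq)
... | ys , zs , refl , |ys| , |zs| = x ∷ ys , zs , refl , cong suc |ys| , |zs|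

consᴹ*-++ : ∀ xs ys w → consᴹ* (xs ++ ys) w ≡ consᴹ* xs (consᴹ* ys w)
consᴹ*-++ xs ys w = Listₚ.foldr-++ _ w xs ys

consᴹ*-normal : ∀ xs {w} → Normal w → Normal (consᴹ* xs w)
consᴹ*-normal []       nw = nw
consᴹ*-normal (x ∷ xs) nw = push-normal (L x) (consᴹ*-normal xs nw)

upFrom : ℕ → ℕ → List ℕ
upFrom K zero    = []
upFrom K (suc d) = K ∷ upFrom (suc K) d

length-upFrom : ∀ K d → length (upFrom K d) ≡ d
length-upFrom K zero    = refl
length-upFrom K (suc d) = cong suc (length-upFrom (suc K) d)

consᴹ*-upFrom : ∀ κ K d r → consᴹ* (upFrom K d) (tok κ (d + K) ∷ r) ≡ tok κ K ∷ r
consᴹ*-upFrom κ K zero    r = refl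
consᴹ*-upFrom κ K (suc d) r = begin
  push (L K) (consᴹ* (upFrom (suc K) d) (tok κ (suc (d + K)) ∷ r))  ≡⟨ cong (λ j → push (L K) (consᴹ* (upFrom (suc K) d) (tok κ j ∷ r))) (+-suc d K) ⟨
  push (L K) (consᴹ* (upFrom (suc K) d) (tok κ (d + suc K) ∷ r))    ≡⟨ cong (push (L K)) (consᴹ*-upFrom κ K' d r) ⟩
  push (L K) (tok κ (suc K) ∷ r)                                     ≡⟨ push-fused r (absorb κ K) ⟩
  tok κ K ∷ r                                                        ∎
  where open ≡-Reasoning
        K' = suc K

maxIdx : List Sym → ℕ
maxIdx []      = 0
maxIdx (x ∷ w) = idx x ⊔ maxIdx w

Below-maxIdx : ∀ {B} w → maxIdx w < B → Below B w
Below-maxIdx []      _ = []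
Below-maxIdx (x ∷ w) p =
  ≤-<-trans (m≤m⊔n (idx x) (maxIdx w)) p ∷ Below-maxIdx w (≤-<-trans (m≤n⊔m (idx x) (maxIdx w)) p)

module _ {P : List Sym → Set} {n : ℕ} (premises : InductionPremises P n) (bound : ℕ)
         (swap : ∀ κ {r} B i → bound < B → B < i → Below B r → Normal (tok κ i ∷ r) →
                 P (L B ∷ r) → P (tok κ i ∷ r)) where
  open InductionPremises premises

  private
    m : ℕ
    m = suc n

    letters : ∀ xs → All (ValElem ι) xs
    letters = All.universal (λ _ → tt)

    div-mod : ∀ k → k ≡ k / m * m + k % m
    div-mod k = trans (m≡m%n+[m/n]*n k m) (+-comm (k % m) (k / m * m))

  steps : ∀ q xs {Y} → length xs ≡ q * m → Normal Y → P Y → P (consᴹ* xs Y)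
  steps zero    []      _   _  pY = pY
  steps (suc q) xs {Y} len nY pY with splitAt-length m xs len
  ... | ys , zs , refl , |ys| , |zs| =
    subst P (sym (consᴹ*-++ ys zs Y))
      (step ys (letters ys) |ys| _ (consᴹ*-normal zs nY) (steps q zs |zs| nY pY))

  standard : ∀ xs → P (consᴹ* xs [])
  standard xs with splitAt-length (length xs / m * m) xs (div-mod (length xs))
  ... | ys , zs , xs≡ys++zs , |ys| , |zs| =
    subst (λ w → P (consᴹ* w [])) (sym xs≡ys++zs) (subst P (sym (consᴹ*-++ ys zs []))
      (steps (length xs / m) ys |ys| (consᴹ*-normal zs []) (base zs (letters zs) |zs|≤n)))
    where
    |zs|≤n : length zs ≤ n
    |zs|≤n = ≤-pred (subst (_< m) (sym |zs|) (m%n<n (length xs) m))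

  P-consᴹ* : ∀ r → Normal r → ∀ xs → P (consᴹ* xs r)
  P-consᴹ* []            _  xs = standard xs
  P-consᴹ* (L a ∷ r)     nr xs =
    subst P (trans (consᴹ*-++ xs (a ∷ []) r) (cong (consᴹ* xs) (push-normal-head nr)))
      (P-consᴹ* r (Linked.tail nr) (xs ++ a ∷ []))
  P-consᴹ* (tok κ K ∷ r) nr xs =
    subst P (trans (consᴹ*-++ xs (upFrom K d) _) (cong (consᴹ* xs) (consᴹ*-upFrom κ K d r)))
      (steps J (xs ++ upFrom K d) len (Normal-reindex κ i nr)
        (swap κ B i bound<B B<i r<B (Normal-reindex κ i nr)
          (subst P (push-normal-head (Normal-L∷ r<B (Linked.tail nr)))
            (P-consᴹ* r (Linked.tail nr) (B ∷ [])))))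
    where
    -- d makes the unfolded prefix xs ++ upFrom K d a multiple of m long and i = d + K > B.
    B = suc (bound ⊔ maxIdx r)
    J = length xs + suc B
    d = suc B + J * n
    i = d + K
    bound<B : bound < B
    bound<B = s≤s (m≤m⊔n bound (maxIdx r))
    r<B : Below B r
    r<B = Below-maxIdx r (s≤s (m≤n⊔m bound (maxIdx r)))
    B<i : B < i
    B<i = ≤-trans (m≤m+n (suc B) (J * n)) (m≤m+n d K)
    len : length (xs ++ upFrom K d) ≡ J * m
    len = begin
      length (xs ++ upFrom K d)      ≡⟨ Listₚ.length-++ xs ⟩
      length xs + length (upFrom K d) ≡⟨ cong (length xs +_) (length-upFrom K d) ⟩
      length xs + (suc B + J * n)    ≡⟨ +-assoc (length xs) (suc B) (J * n) ⟨
      J + J * n                      ≡⟨ *-suc J n ⟨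
      J * m                          ∎
      where open ≡-Reasoning

  all-normal : ∀ X → Normal X → P X
  all-normal X nX = P-consᴹ* X nX []

size : ∀ s → Val s → ℕ
size ι   k = k
size lst w = maxIdx w

envSize : ∀ Δ → Env Δ → ℕ
envSize []      ρ = 0
envSize (s ∷ Δ) ρ = size s (ρ here) ⊔ envSize Δ (λ x → ρ (there x))

envSize-small : ∀ Δ (ρ : Env Δ) {B} → envSize Δ ρ < B → ∀ {s} (x : Δ ∋ s) → Small B s (ρ x)
envSize-small (s ∷ Δ) ρ p here      = size-small s (≤-<-trans (m≤m⊔n _ _) p)
  where
  size-small : ∀ {B} s {v} → size s v < B → Small B s v
  size-small ι   p = p
  size-small lst p = Below-maxIdx _ p
envSize-small (s ∷ Δ) ρ p (there x) = envSize-small Δ (λ y → ρ (there y)) (≤-<-trans (m≤n⊔m _ _) p) x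

Ind-valid : ∀ n {Δ} (φ : Formula (lst ∷ Δ)) → QF φ → (η : Env Δ) → ElemEnv η → ⟦ Ind n φ ⟧ η
Ind-valid n {Δ} φ qf η elems premises =
  all-normal (⟦Ind-premises⟧ φ η n premises) (envSize Δ η)
    λ κ B i size<B B<i r<B nr → Swap.swap B i B<i qf elems (envSize-small Δ η size<B) κ r<B nr

T1+IND-valid : ∀ {ψ} → T1+IND ψ → ⟦ ψ ⟧ ∅
T1+IND-valid ax-nil≠cons X _ x _ nil≡cons = push-≢-[] (L x) X (sym nil≡cons)
T1+IND-valid ax-cons-inj X _ x _ Y _ y _ cons≡cons =
  ,-injective (trans (sym (uncons-push x X)) (trans (cong uncons cons≡cons) (uncons-push y Y)))
T1+IND-valid ax-nil⌢ Y _ = refl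
T1+IND-valid ax-cons⌢ X _ x _ Y _ = append-push (L x) X Y
T1+IND-valid (ax-ind n Δ φ qf) = ⟦close⟧ Δ (Ind n φ) (Ind-valid n φ qf)

leftCancelNil-fails : ¬ ⟦ leftCancelNil ⟧ ∅
leftCancelNil-fails leftCancel with leftCancel (tok W 0 ∷ []) [-] (tok S 0 ∷ []) [-] refl
... | ()

theorem4p7 : ¬ (T1+IND ⊢ leftCancelNil)
theorem4p7 = leftCancelNil-fails ∘ Soundness.⊢-sound T1+IND-valid
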